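{- Let \(\mathcal V\) be a universe. There exists a nontrivial locally small \(\delta_{\mathcal V}\)-complete poset with decidable equality if and only if weak excluded middle in \(\mathcal V\) holds.
   Context: Setting: univalent foundations (intensional Martin-Löf type theory with universes, function extensionality, propositional extensionality, propositional truncation); excluded middle and propositional resizing are not assumed. A proposition is a type with at most one element. Weak excluded middle in \(\mathcal V\): for every proposition \(P:\mathcal V\), either \(\neg P\) or \(\neg\neg P\). A type has decidable equality if for all \(a,b\) either \(a=b\) or \(a\neq b\). A poset is a type \(X\) with a proposition-valued reflexive, transitive, antisymmetric relation \(\sqsubseteq\). For \(x\sqsubseteq y\) and a proposition \(P:\mathcal V\), \(\delta_{x,y,P}:\mathbf 1+P\to X\) sends \(\mathrm{inl}(\star)\mapsto x\), \(\mathrm{inr}(p)\mapsto y\); the poset is \(\delta_{\mathcal V}\)-complete if all such families have suprema. It is locally small if there is \(\sqsubseteq_{\mathcal V}:X\to X\to\mathcal V\) with \((x\sqsubseteq y)\simeq(x\sqsubseteq_{\mathcal V}y)\) for all \(x,y\). It is nontrivial if it comes with designated elements \(x,y\) with \(x\sqsubseteq y\) and \(x\neq y\). -}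

module Defs where

open import Level using (Level; _⊔_; suc)
open import Data.Unit using (⊤; tt)
open import Data.Sum using (_⊎_; inj₁; inj₂)
open import Data.Product using (Σ; _×_; _,_)
open import Relation.Nullary using (¬_)
open import Relation.Binary.PropositionalEquality using (_≡_)
open import Relation.Binary.Definitions using (DecidableEquality)
open import Function.Bundles using (_↔_)

isProp : ∀ {ℓ} → Set ℓ → Set ℓ
isProp A = (a b : A) → a ≡ b

record Poset (𝒰 𝒯 : Level) : Set (suc (𝒰 ⊔ 𝒯)) where
  field
    Carrier     : Set 𝒰
    _⊑_         : Carrier → Carrier → Set 𝒯
    ⊑-prop      : (x y : Carrier) → isProp (x ⊑ y)
    ⊑-refl      : (x : Carrier) → x ⊑ x
    ⊑-trans     : (x y z : Carrier) → x ⊑ y → y ⊑ z → x ⊑ z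
    ⊑-antisym   : (x y : Carrier) → x ⊑ y → y ⊑ x → x ≡ y

module _ {𝒰 𝒯 : Level} (X : Poset 𝒰 𝒯) where
  open Poset X

  isSup : ∀ {𝒱} {I : Set 𝒱} → (I → Carrier) → Carrier → Set (𝒰 ⊔ 𝒯 ⊔ 𝒱)
  isSup {I = I} α s = ((i : I) → α i ⊑ s)
                    × ((u : Carrier) → ((i : I) → α i ⊑ u) → s ⊑ u)

  δ : ∀ {𝒱} (x y : Carrier) (P : Set 𝒱) → ⊤ ⊎ P → Carrier
  δ x y P (inj₁ _) = x
  δ x y P (inj₂ _) = y

  δ-complete : (𝒱 : Level) → Set (𝒰 ⊔ 𝒯 ⊔ suc 𝒱)
  δ-complete 𝒱 = (x y : Carrier) → x ⊑ y → (P : Set 𝒱) → isProp P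
               → Σ Carrier (λ s → isSup (δ x y P) s)

  locally-small : (𝒱 : Level) → Set (𝒰 ⊔ 𝒯 ⊔ suc 𝒱)
  locally-small 𝒱 = Σ (Carrier → Carrier → Set 𝒱)
                      (λ _⊑ᵥ_ → (x y : Carrier) → (x ⊑ y) ↔ (x ⊑ᵥ y))

  nontrivial : Set (𝒰 ⊔ 𝒯)
  nontrivial = Σ Carrier (λ x → Σ Carrier (λ y → (x ⊑ y) × ¬ (x ≡ y)))

  has-decidable-equality : Set 𝒰
  has-decidable-equality = DecidableEquality Carrier

WEM : (𝒱 : Level) → Set (suc 𝒱)
WEM 𝒱 = (P : Set 𝒱) → isProp P → (¬ P) ⊎ (¬ ¬ P)

NontrivialLSδCompleteDecPoset : (𝒰 𝒯 𝒱 : Level) → Set (suc (𝒰 ⊔ 𝒯 ⊔ 𝒱))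
NontrivialLSδCompleteDecPoset 𝒰 𝒯 𝒱 =
  Σ (Poset 𝒰 𝒯) (λ X → nontrivial X × locally-small X 𝒱
                       × δ-complete X 𝒱 × has-decidable-equality X)

{-# OPTIONS --safe #-}
module Submission where

-- The supremum of δ_{x,y,P} is x when ¬ P and y when ¬ ¬ P. With decidable
-- equality one may ask whether it equals x, and either answer decides between
-- ¬ P and ¬ ¬ P. Conversely, under weak excluded middle these two cases cover
-- every proposition, so any poset with ¬¬-stable order, such as the
-- two-element chain, is δ-complete.

open import Defs
open import Level using (Level; Lift; lift; lower)
open import Data.Bool using (Bool; false; true; _≤_; f≤t)
open import Data.Bool.Properties as Bool
  using (≤-refl; ≤-trans; ≤-antisym; ≤-irrelevant; _≤?_)
open import Data.Empty using (⊥-elim)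
open import Data.Product using (_×_; _,_; proj₁)
open import Data.Sum using (inj₁; inj₂)
open import Data.Unit using (tt)
open import Function.Bundles using (mk↔ₛ′)
open import Relation.Nullary using (¬_; Stable)
open import Relation.Nullary.Decidable using (decidable-stable; map′; yes; no)
open import Relation.Binary.PropositionalEquality using (_≡_; refl; cong)

module _ {𝒰 𝒯 : Level} (X : Poset 𝒰 𝒯) where
  open Poset X

  module _ {𝒱 : Level} {P : Set 𝒱} {x y : Carrier} where

    ¬P⇒x-isSup-δ : ¬ P → isSup X (δ X x y P) x
    ¬P⇒x-isSup-δ ¬p = ub , λ _ bounds → bounds (inj₁ tt)
      where
      ub : ∀ i → δ X x y P i ⊑ x
      ub (inj₁ _) = ⊑-refl x
      ub (inj₂ p) = ⊥-elim (¬p p)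

    ¬¬P⇒y-isSup-δ : (∀ a b → Stable (a ⊑ b)) → x ⊑ y → ¬ ¬ P → isSup X (δ X x y P) y
    ¬¬P⇒y-isSup-δ stable x⊑y ¬¬p = ub , least
      where
      ub : ∀ i → δ X x y P i ⊑ y
      ub (inj₁ _) = x⊑y
      ub (inj₂ _) = ⊑-refl y

      least : ∀ u → (∀ i → δ X x y P i ⊑ u) → y ⊑ u
      least u bounds = stable y u λ y⋢u → ¬¬p λ p → y⋢u (bounds (inj₂ p))

    x-isSup-δ⇒¬P : x ⊑ y → ¬ x ≡ y → isSup X (δ X x y P) x → ¬ P
    x-isSup-δ⇒¬P x⊑y x≢y (ub , _) p = x≢y (⊑-antisym x y x⊑y (ub (inj₂ p)))

    δ-sup≢x⇒¬¬P : ∀ {s} → isSup X (δ X x y P) s → ¬ s ≡ x → ¬ ¬ P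
    δ-sup≢x⇒¬¬P {s} (ub , least) s≢x ¬p =
      s≢x (⊑-antisym s x (least x (proj₁ (¬P⇒x-isSup-δ ¬p))) (ub (inj₁ tt)))

  δ-complete⇒WEM : ∀ {𝒱} → nontrivial X → has-decidable-equality X → δ-complete X 𝒱 → WEM 𝒱
  δ-complete⇒WEM (x , y , x⊑y , x≢y) _≟_ complete P P-prop
    with complete x y x⊑y P P-prop
  ... | s , s-sup with s ≟ x
  ...   | yes refl = inj₁ (x-isSup-δ⇒¬P x⊑y x≢y s-sup)
  ...   | no s≢x   = inj₂ (δ-sup≢x⇒¬¬P s-sup s≢x)

  WEM⇒δ-complete : ∀ {𝒱} → (∀ a b → Stable (a ⊑ b)) → WEM 𝒱 → δ-complete X 𝒱
  WEM⇒δ-complete stable wem x y x⊑y P P-prop with wem P P-prop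
  ... | inj₁ ¬p  = x , ¬P⇒x-isSup-δ ¬p
  ... | inj₂ ¬¬p = y , ¬¬P⇒y-isSup-δ stable x⊑y ¬¬p

module _ {𝒰 𝒯 : Level} where

  Bool-poset : Poset 𝒰 𝒯
  Bool-poset = record
    { Carrier   = Lift 𝒰 Bool
    ; _⊑_       = λ a b → Lift 𝒯 (lower a ≤ lower b)
    ; ⊑-prop    = λ _ _ (lift p) (lift q) → cong lift (≤-irrelevant p q)
    ; ⊑-refl    = λ _ → lift ≤-refl
    ; ⊑-trans   = λ _ _ _ (lift p) (lift q) → lift (≤-trans p q)
    ; ⊑-antisym = λ _ _ (lift p) (lift q) → cong lift (≤-antisym p q)
    }

  open Poset Bool-poset

  Bool-nontrivial : nontrivial Bool-poset
  Bool-nontrivial = lift false , lift true , lift f≤t , λ ()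

  Bool-locally-small : ∀ {𝒱} → locally-small Bool-poset 𝒱
  Bool-locally-small {𝒱} =
    (λ a b → Lift 𝒱 (lower a ≤ lower b)) ,
    λ _ _ → mk↔ₛ′ (λ p → lift (lower p)) (λ p → lift (lower p)) (λ _ → refl) (λ _ → refl)

  Bool-≟ : has-decidable-equality Bool-poset
  Bool-≟ a b = map′ (cong lift) (cong lower) (lower a Bool.≟ lower b)

  Bool-⊑-stable : ∀ a b → Stable (a ⊑ b)
  Bool-⊑-stable a b = decidable-stable (map′ lift lower (lower a ≤? lower b))

theorem3p25 : (𝒰 𝒯 𝒱 : Level)
    → (NontrivialLSδCompleteDecPoset 𝒰 𝒯 𝒱 → WEM 𝒱)
    × (WEM 𝒱 → NontrivialLSδCompleteDecPoset 𝒰 𝒯 𝒱)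
theorem3p25 𝒰 𝒯 𝒱 =
  (λ (X , X-nontrivial , _ , X-complete , X-≟) →
     δ-complete⇒WEM X X-nontrivial X-≟ X-complete) ,
  (λ wem → Bool-poset , Bool-nontrivial , Bool-locally-small {𝒰} {𝒯} ,
           WEM⇒δ-complete Bool-poset Bool-⊑-stable wem , Bool-≟ {𝒰} {𝒯})
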